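{- Let $c \ge 2$ and write $c = 3s + t$ with $s \in \mathbb{N}_0$ and $t \in \{2,3,4\}$ (these are uniquely determined). Consider the Static Black-Peg AB Game with $p=2$ pegs and $c$ colors, and the list of questions obtained as follows. First take the base questions: for $t=2$ the single question $(1\,|\,2)$; for $t=3$ the questions $(1\,|\,2),(3\,|\,1)$; for $t=4$ the questions $(1\,|\,3),(3\,|\,1),(2\,|\,3),(3\,|\,2)$. Then, for each $l=1,2,\dots,s$, append the four questions $(1+d_l\,|\,3+d_l)$, $(3+d_l\,|\,1+d_l)$, $(2+d_l\,|\,3+d_l)$, $(3+d_l\,|\,2+d_l)$, where $d_l = t+3(l-1)$. This list consists of exactly $\lceil 4c/3\rceil-2$ questions, and it is a feasible and optimal $(\lceil 4c/3 \rceil-1)$-strategy; that is, the answers to these questions uniquely determine every secret, and no feasible strategy consisting of fewer than $\lceil 4c/3\rceil-2$ questions exists.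
   Context: Static Black-Peg AB Game with $p$ pegs and $c \ge p$ colors: the colors are $1,2,\dots,c$. A secret and a question are both ordered $p$-tuples $(x_1\,|\,x_2\,|\,\dots\,|\,x_p)$ of pairwise distinct colors. The answer to a question $Q=(q_1\,|\,\dots\,|\,q_p)$ for a secret $S=(s_1\,|\,\dots\,|\,s_p)$ is the number of positions (pegs) $i$ with $q_i=s_i$. A strategy is a list of $k$ pairwise distinct questions (the main questions) which the codebreaker asks all at once at the beginning; it is called a $(k+1)$-strategy (the extra one counting the final question, which is the secret itself). The strategy is feasible if any two distinct secrets receive different vectors of answers to the $k$ questions. A $(k+1)$-strategy is optimal if it is feasible and there is no feasible strategy with fewer than $k$ questions. -}

module Defs where

open import Data.Nat using (ℕ; zero; suc; _+_; _*_; _∸_; _≤_; _/_)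
open import Data.Nat.Properties using (_≟_)
open import Data.Product using (_×_; _,_)
open import Data.List using (List; []; _∷_; _++_; map)
open import Relation.Binary.PropositionalEquality using (_≡_; _≢_)
open import Relation.Nullary.Decidable using (⌊_⌋)
open import Data.Bool using (if_then_else_)

Code : Set
Code = ℕ × ℕ

ValidCode : ℕ → Code → Set
ValidCode c (x , y) = (1 ≤ x × x ≤ c) × (1 ≤ y × y ≤ c) × x ≢ y

answer : Code → Code → ℕ
answer (q₁ , q₂) (s₁ , s₂) =
  (if ⌊ q₁ ≟ s₁ ⌋ then 1 else 0) + (if ⌊ q₂ ≟ s₂ ⌋ then 1 else 0)

answers : List Code → Code → List ℕ
answers qs S = map (λ q → answer q S) qs

Feasible : ℕ → List Code → Set
Feasible c qs = ∀ S S′ → ValidCode c S → ValidCode c S′ →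
  answers qs S ≡ answers qs S′ → S ≡ S′

⌈_/3⌉ : ℕ → ℕ
⌈ n /3⌉ = (n + 2) / 3

base : ℕ → List Code
base 2 = (1 , 2) ∷ []
base 3 = (1 , 2) ∷ (3 , 1) ∷ []
base 4 = (1 , 3) ∷ (3 , 1) ∷ (2 , 3) ∷ (3 , 2) ∷ []
base _ = []

block : ℕ → List Code
block d = (1 + d , 3 + d) ∷ (3 + d , 1 + d) ∷ (2 + d , 3 + d) ∷ (3 + d , 2 + d) ∷ []

blocks : ℕ → ℕ → List Code
blocks t zero = []
blocks t (suc s) = blocks t s ++ block (t + 3 * s)

strategy : ℕ → ℕ → List Code
strategy s t = base t ++ blocks t s

-- A block on the colors d + 1, d + 2, d + 3 answers a secret in a way that
-- determines which of these colors it uses in each position (after shifting, a finite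
-- check for d = 0), while the earlier questions, which only use colors ≤ d, cannot see
-- them. Replacing invisible colors by a blank 0, induction on the number of blocks shows
-- that the answers separate any two partial secrets with blanks in the same positions;
-- the three base lists are checked exhaustively.
--
-- Read the K questions as arcs x → y between colors. For every color v,
-- 2 ≤ out(v) + [out(v) = 1] + 2 [out(v) = 0], so 2c ≤ K + N + 2Z, where N counts colors
-- of outdegree 1 and Z colors of outdegree 0; likewise for indegrees. For c ≥ 3 there is
-- at most one color of outdegree 0, since two such colors z, z′ give secrets (z , b) and
-- (z′ , b) with the same answers; likewise for indegree 0. Call a question (x , y)
-- isolated if out(x) = in(y) = 1. Two isolated questions must be linked (the first color
-- of one is the second color of the other), for otherwise exchanging their second colors
-- gives two secrets with the same answers; hence there are at most three of them, and at
-- most two when colors of outdegree 0 and of indegree 0 both exist. A question contributes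
-- to both N's only if it is isolated, and adding everything up gives 4c ≤ 3K + 6.

module Submission where

open import Defs
open import Data.Nat using (ℕ; zero; suc; _+_; _*_; _∸_; _/_; _≤_; _<_; z≤n; s≤s; s≤s⁻¹; _≤?_; _≡ᵇ_)
open import Data.Nat.Properties
open import Data.Product as Product using (_×_; _,_; proj₁; proj₂; ∃-syntax)
open import Data.Product.Properties using (,-injectiveˡ; ,-injectiveʳ; ≡-dec)
open import Data.Sum using (_⊎_; inj₁; inj₂)
import Data.Sum as Sum
open import Data.List using (List; []; _∷_; _++_; length; filter; upTo; applyUpTo; cartesianProduct)
open import Data.List.Properties using (++-assoc; ++-identityʳ; length-++; length-applyUpTo; map-cong-local; ∷-injective)
import Data.List.Properties as List
open import Data.List.Membership.Propositional using (_∈_)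
open import Data.List.Membership.Propositional.Properties using (∈-cartesianProduct⁺; ∈-upTo⁺; ∈-applyUpTo⁺; ∈-applyUpTo⁻; ∈-filter⁻)
open import Data.List.Relation.Unary.All as All using (All; []; _∷_)
import Data.List.Relation.Unary.All.Properties as All
open import Data.List.Relation.Unary.Any using (here; there)
open import Data.List.Relation.Unary.AllPairs as AllPairs using (AllPairs; []; _∷_; allPairs?)
open import Data.List.Relation.Unary.Unique.Propositional using (Unique)
import Data.List.Relation.Unary.Unique.Propositional.Properties as Unique
open import Data.Bool using (if_then_else_)
import Data.Bool.Properties as Bool
open import Data.List.Relation.Binary.Disjoint.Propositional using (Disjoint)
open import Data.Empty using (⊥; ⊥-elim)
open import Data.Unit using (tt)
open import Relation.Nullary using (Dec; yes; no; ¬?)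
open import Relation.Nullary.Decidable using (⌊_⌋; True; toWitness; _×-dec_; _→-dec_)
open import Relation.Binary.PropositionalEquality
open import Data.Nat.Tactic.RingSolver using (solve-∀)
open import Data.Nat.DivMod using (/-congˡ; +-distrib-/-∣ˡ; m*n/n≡m; m<n⇒m/n≡0; m<n*o⇒m/o<n)
open import Data.Nat.Divisibility using (n∣m*n)
open import Function using (_∘_)

-- Indicators, finite sums and degrees

-- answer (x , y) (a , b) unfolds to δ x a + δ y b.
δ : ℕ → ℕ → ℕ
δ x y = if ⌊ x ≟ y ⌋ then 1 else 0

δ-≡ : ∀ {x y} → x ≡ y → δ x y ≡ 1
δ-≡ {x} {y} x≡y with x ≟ y
... | yes _ = refl
... | no x≢y = ⊥-elim (x≢y x≡y)

δ-≢ : ∀ {x y} → x ≢ y → δ x y ≡ 0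
δ-≢ {x} {y} x≢y with x ≟ y
... | yes x≡y = ⊥-elim (x≢y x≡y)
... | no _ = refl

δ-suc : ∀ x y → δ (suc x) (suc y) ≡ δ x y
δ-suc x y with x ≟ y
... | yes x≡y = δ-≡ (cong suc x≡y)
... | no x≢y = δ-≢ (x≢y ∘ suc-injective)

δ-shift : ∀ k d x → δ (suc k + d) x ≡ δ (suc k) (x ∸ d)
δ-shift k zero x = cong (λ n → δ n x) (+-identityʳ (suc k))
δ-shift k (suc d) zero = trans (δ-≢ {suc k + suc d} {0} λ ()) (sym (δ-≢ {suc k} {0} λ ()))
δ-shift k (suc d) (suc x) = begin
  δ (suc k + suc d) (suc x)    ≡⟨ cong (λ n → δ n (suc x)) (+-suc (suc k) d) ⟩
  δ (suc (suc k + d)) (suc x)  ≡⟨ δ-suc (suc k + d) x ⟩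
  δ (suc k + d) x              ≡⟨ δ-shift k d x ⟩
  δ (suc k) (x ∸ d)            ∎
  where open ≡-Reasoning

𝟙 : ∀ {A : Set} → Dec A → ℕ
𝟙 a? = if ⌊ a? ⌋ then 1 else 0

𝟙-pair : ∀ {A B : Set} (a? : Dec A) (b? : Dec B) → 𝟙 a? + 𝟙 b? ≤ 1 + 𝟙 (a? ×-dec b?)
𝟙-pair (yes _) (yes _) = ≤-refl
𝟙-pair (yes _) (no _) = ≤-refl
𝟙-pair (no _) (yes _) = ≤-refl
𝟙-pair (no _) (no _) = z≤n

∑ : ∀ {A : Set} → List A → (A → ℕ) → ℕ
∑ [] f = 0
∑ (x ∷ xs) f = f x + ∑ xs f

syntax ∑ xs (λ x → e) = ∑[ x ∈ xs ] e

module _ {A : Set} where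

  ∑-+ : ∀ (xs : List A) f g → ∑[ x ∈ xs ] (f x + g x) ≡ ∑ xs f + ∑ xs g
  ∑-+ [] f g = refl
  ∑-+ (x ∷ xs) f g rewrite ∑-+ xs f g = +-+-assoc-swap (f x) (g x) (∑ xs f) (∑ xs g)
    where
    +-+-assoc-swap : ∀ a b c d → a + b + (c + d) ≡ a + c + (b + d)
    +-+-assoc-swap = solve-∀

  ∑-cong : ∀ (xs : List A) {f g} → (∀ x → f x ≡ g x) → ∑ xs f ≡ ∑ xs g
  ∑-cong [] f≗g = refl
  ∑-cong (x ∷ xs) f≗g = cong₂ _+_ (f≗g x) (∑-cong xs f≗g)

  ∑-*ˡ : ∀ (xs : List A) k f → ∑[ x ∈ xs ] (k * f x) ≡ k * ∑ xs f
  ∑-*ˡ [] k f = sym (*-zeroʳ k)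
  ∑-*ˡ (x ∷ xs) k f rewrite ∑-*ˡ xs k f = sym (*-distribˡ-+ k (f x) (∑ xs f))

  ∑-const : ∀ (xs : List A) k → ∑[ _ ∈ xs ] k ≡ length xs * k
  ∑-const [] k = refl
  ∑-const (x ∷ xs) k = cong (k +_) (∑-const xs k)

  ∑-mono-≤ : ∀ (xs : List A) {f g} → (∀ x → f x ≤ g x) → ∑ xs f ≤ ∑ xs g
  ∑-mono-≤ [] f≤g = z≤n
  ∑-mono-≤ (x ∷ xs) f≤g = +-mono-≤ (f≤g x) (∑-mono-≤ xs f≤g)

  ∑-zero : ∀ {xs : List A} {f} → All (λ x → f x ≡ 0) xs → ∑ xs f ≡ 0
  ∑-zero [] = refl
  ∑-zero (fx≡0 ∷ fxs≡0) rewrite fx≡0 = ∑-zero fxs≡0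

  ∑-zero⁻ : ∀ {xs : List A} {f x} → ∑ xs f ≡ 0 → x ∈ xs → f x ≡ 0
  ∑-zero⁻ {y ∷ xs} {f} sum≡0 (here refl) = m+n≡0⇒m≡0 (f y) sum≡0
  ∑-zero⁻ {y ∷ xs} {f} sum≡0 (there x∈xs) = ∑-zero⁻ (m+n≡0⇒n≡0 (f y) sum≡0) x∈xs

  ∑-filter : ∀ {P : A → Set} (P? : ∀ x → Dec (P x)) xs → ∑[ x ∈ xs ] 𝟙 (P? x) ≡ length (filter P? xs)
  ∑-filter P? [] = refl
  ∑-filter P? (x ∷ xs) with P? x
  ... | yes _ = cong suc (∑-filter P? xs)
  ... | no _ = ∑-filter P? xs

∑-δ : ∀ {vs x} (h : ℕ → ℕ) → Unique vs → x ∈ vs → ∑[ v ∈ vs ] (δ x v * h v) ≡ h x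
∑-δ {x ∷ vs} h (x∉vs ∷ _) (here refl) = begin
  δ x x * h x + ∑[ v ∈ vs ] (δ x v * h v)  ≡⟨ cong₂ _+_ (cong (_* h x) (δ-≡ {x} refl)) others ⟩
  1 * h x + 0                             ≡⟨ trans (+-identityʳ _) (*-identityˡ _) ⟩
  h x                                     ∎
  where
  open ≡-Reasoning
  others : ∑[ v ∈ vs ] (δ x v * h v) ≡ 0
  others = ∑-zero (All.map (λ x≢v → cong (_* h _) (δ-≢ x≢v)) x∉vs)
∑-δ {v ∷ vs} {x} h (v∉vs ∷ unique) (there x∈vs) rewrite δ-≢ {x} {v} (λ { refl → All.lookup v∉vs x∈vs refl }) =
  ∑-δ h unique x∈vs

degree : ∀ {A : Set} → (A → ℕ) → List A → ℕ → ℕ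
degree key qs v = ∑[ q ∈ qs ] δ (key q) v

module _ {A : Set} (key : A → ℕ) where

  ∑-degree : ∀ {vs} qs (h : ℕ → ℕ) → Unique vs → All (λ q → key q ∈ vs) qs →
             ∑[ q ∈ qs ] h (key q) ≡ ∑[ v ∈ vs ] (degree key qs v * h v)
  ∑-degree {vs} [] h _ [] = sym (trans (∑-const vs 0) (*-zeroʳ (length vs)))
  ∑-degree {vs} (q ∷ qs) h unique (key∈ ∷ keys∈) = sym (begin
    ∑[ v ∈ vs ] ((δ (key q) v + degree key qs v) * h v)
      ≡⟨ ∑-cong vs (λ v → *-distribʳ-+ (h v) (δ (key q) v) (degree key qs v)) ⟩
    ∑[ v ∈ vs ] (δ (key q) v * h v + degree key qs v * h v)
      ≡⟨ ∑-+ vs _ _ ⟩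
    ∑[ v ∈ vs ] (δ (key q) v * h v) + ∑[ v ∈ vs ] (degree key qs v * h v)
      ≡⟨ cong₂ _+_ (∑-δ h unique key∈) (sym (∑-degree qs h unique keys∈)) ⟩
    h (key q) + ∑[ q ∈ qs ] h (key q) ∎)
    where open ≡-Reasoning

  handshake : ∀ {vs} qs → Unique vs → All (λ q → key q ∈ vs) qs → ∑[ v ∈ vs ] degree key qs v ≡ length qs
  handshake {vs} qs unique keys∈ = begin
    ∑[ v ∈ vs ] degree key qs v         ≡⟨ ∑-cong vs (λ v → sym (*-identityʳ (degree key qs v))) ⟩
    ∑[ v ∈ vs ] (degree key qs v * 1)   ≡⟨ sym (∑-degree qs (λ _ → 1) unique keys∈) ⟩
    ∑[ _ ∈ qs ] 1                       ≡⟨ ∑-const qs 1 ⟩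
    length qs * 1                       ≡⟨ *-identityʳ (length qs) ⟩
    length qs                           ∎
    where open ≡-Reasoning

  degree-zero : ∀ {qs v q} → degree key qs v ≡ 0 → q ∈ qs → key q ≢ v
  degree-zero deg≡0 q∈qs key≡v = 0≢1+n (trans (sym (∑-zero⁻ deg≡0 q∈qs)) (δ-≡ key≡v))

  degree-one : ∀ {qs v q q′} → degree key qs v ≡ 1 → q ∈ qs → q′ ∈ qs → key q ≡ v → key q′ ≡ v → q ≡ q′
  degree-one {p ∷ qs} {v} deg≡1 q∈ q′∈ key≡v key′≡v with key p ≟ v
  degree-one deg≡1 (here refl) (here refl) _ _ | yes _ = refl
  degree-one deg≡1 (here refl) (there q′∈) _ key′≡v | yes _ = ⊥-elim (degree-zero (suc-injective deg≡1) q′∈ key′≡v)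
  degree-one deg≡1 (there q∈) _ key≡v _ | yes _ = ⊥-elim (degree-zero (suc-injective deg≡1) q∈ key≡v)
  degree-one deg≡1 (here refl) _ key≡v _ | no key≢v = ⊥-elim (key≢v key≡v)
  degree-one deg≡1 (there _) (here refl) _ key′≡v | no key≢v = ⊥-elim (key≢v key′≡v)
  degree-one deg≡1 (there q∈) (there q′∈) key≡v key′≡v | no _ = degree-one deg≡1 q∈ q′∈ key≡v key′≡v

-- Colors and exhaustive search over codes

Color : ℕ → ℕ → Set
Color c v = 1 ≤ v × v ≤ c

colors : ℕ → List ℕ
colors c = applyUpTo suc c

colors-unique : ∀ c → Unique (colors c)
colors-unique c = Unique.applyUpTo⁺₁ suc c (λ i<j _ → <⇒≢ (s≤s i<j))

∈-colors⁺ : ∀ {c v} → Color c v → v ∈ colors c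
∈-colors⁺ {v = suc i} (_ , v≤c) = ∈-applyUpTo⁺ suc v≤c

∈-colors⁻ : ∀ {c v} → v ∈ colors c → Color c v
∈-colors⁻ v∈ with ∈-applyUpTo⁻ suc v∈
... | _ , i<c , refl = s≤s z≤n , i<c

_≟ᶜ_ : (S S′ : Code) → Dec (S ≡ S′)
_≟ᶜ_ = ≡-dec _≟_ _≟_

codesUpTo : ℕ → List Code
codesUpTo d = cartesianProduct (upTo (suc d)) (upTo (suc d))

∈-codesUpTo : ∀ {d a b} → a ≤ d → b ≤ d → (a , b) ∈ codesUpTo d
∈-codesUpTo a≤d b≤d = ∈-cartesianProduct⁺ (∈-upTo⁺ (s≤s a≤d)) (∈-upTo⁺ (s≤s b≤d))

AllCodePairs : ℕ → (Code → Code → Set) → Set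
AllCodePairs d R = All (λ S → All (R S) (codesUpTo d)) (codesUpTo d)

allCodePairs? : ∀ {R} d → (∀ S S′ → Dec (R S S′)) → Dec (AllCodePairs d R)
allCodePairs? d R? = All.all? (λ S → All.all? (R? S) (codesUpTo d)) (codesUpTo d)

lookupCodePair : ∀ {R d a b a′ b′} → AllCodePairs d R →
                 a ≤ d → b ≤ d → a′ ≤ d → b′ ≤ d → R (a , b) (a′ , b′)
lookupCodePair all a≤ b≤ a′≤ b′≤ = All.lookup (All.lookup all (∈-codesUpTo a≤ b≤)) (∈-codesUpTo a′≤ b′≤)

answers-++⁻ : ∀ P P′ {S S′} → answers (P ++ P′) S ≡ answers (P ++ P′) S′ →
              answers P S ≡ answers P S′ × answers P′ S ≡ answers P′ S′
answers-++⁻ [] P′ eq = refl , eq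
answers-++⁻ (q ∷ P) P′ eq with ∷-injective eq
... | eq₁ , eq₂ with answers-++⁻ P P′ eq₂
...   | eqP , eqP′ = cong₂ _∷_ eq₁ eqP , eqP′

-- The strategy is feasible

block-answers : ∀ d a b → answers (block d) (a , b) ≡ answers (block 0) (a ∸ d , b ∸ d)
block-answers d a b
  rewrite δ-shift 0 d a | δ-shift 1 d a | δ-shift 2 d a
        | δ-shift 0 d b | δ-shift 1 d b | δ-shift 2 d b = refl

block₀-injective : ∀ {x y x′ y′} → x ≤ 3 → y ≤ 3 → x′ ≤ 3 → y′ ≤ 3 →
                   answers (block 0) (x , y) ≡ answers (block 0) (x′ , y′) → (x , y) ≡ (x′ , y′)
block₀-injective = lookupCodePair (toWitness {a? = allCodePairs? 3 decide} tt)
  where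
  decide : ∀ S S′ → Dec (answers (block 0) S ≡ answers (block 0) S′ → S ≡ S′)
  decide S S′ = List.≡-dec _≟_ _ _ →-dec S ≟ᶜ S′

AgreeAbove : ℕ → ℕ → ℕ → Set
AgreeAbove d a a′ = a ≡ a′ ⊎ (a ≤ d × a′ ≤ d)

∸-agreeAbove : ∀ d {a a′} → a ∸ d ≡ a′ ∸ d → AgreeAbove d a a′
∸-agreeAbove zero eq = inj₁ eq
∸-agreeAbove (suc d) {zero} {zero} eq = inj₁ refl
∸-agreeAbove (suc d) {zero} {suc a′} eq = inj₂ (z≤n , s≤s (m∸n≡0⇒m≤n (sym eq)))
∸-agreeAbove (suc d) {suc a} {zero} eq = inj₂ (s≤s (m∸n≡0⇒m≤n eq) , z≤n)
∸-agreeAbove (suc d) {suc a} {suc a′} eq = Sum.map (cong suc) (Product.map s≤s s≤s) (∸-agreeAbove d eq)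

block-reveals : ∀ d {a b a′ b′} → a ≤ 3 + d → b ≤ 3 + d → a′ ≤ 3 + d → b′ ≤ 3 + d →
                answers (block d) (a , b) ≡ answers (block d) (a′ , b′) →
                AgreeAbove d a a′ × AgreeAbove d b b′
block-reveals d {a} {b} {a′} {b′} a≤ b≤ a′≤ b′≤ eq =
  ∸-agreeAbove d (,-injectiveˡ shifted) , ∸-agreeAbove d (,-injectiveʳ shifted)
  where
  below : ∀ {x} → x ≤ 3 + d → x ∸ d ≤ 3
  below {x} x≤ = m≤n+o⇒m∸n≤o x d (subst (x ≤_) (+-comm 3 d) x≤)
  shifted : (a ∸ d , b ∸ d) ≡ (a′ ∸ d , b′ ∸ d)
  shifted = block₀-injective (below a≤) (below b≤) (below a′≤) (below b′≤)
              (trans (sym (block-answers d a b)) (trans eq (block-answers d a′ b′)))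

-- Colors above d are invisible to questions on the colors 1, …, d (answers-hide),
-- so they may be replaced by a blank.
hide : ℕ → ℕ → ℕ
hide d x with x ≤? d
... | yes _ = x
... | no _ = 0

hide-≤ : ∀ {d x} → x ≤ d → hide d x ≡ x
hide-≤ {d} {x} x≤d with x ≤? d
... | yes _ = refl
... | no x≰d = ⊥-elim (x≰d x≤d)

δ-hide : ∀ {d x y} → 1 ≤ y → y ≤ d → δ y x ≡ δ y (hide d x)
δ-hide {d} {x} 1≤y y≤d with x ≤? d
... | yes _ = refl
... | no x≰d = trans (δ-≢ λ { refl → x≰d y≤d }) (sym (δ-≢ λ { refl → <-irrefl refl 1≤y }))

answers-hide : ∀ {d P a b} → All (ValidCode d) P → answers P (a , b) ≡ answers P (hide d a , hide d b)
answers-hide valid = map-cong-local (All.map (λ ((1≤x , x≤d) , (1≤y , y≤d) , _) →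
  cong₂ _+_ (δ-hide 1≤x x≤d) (δ-hide 1≤y y≤d)) valid)

unhide : ∀ {d a a′} → AgreeAbove d a a′ → hide d a ≡ hide d a′ → a ≡ a′
unhide (inj₁ a≡a′) _ = a≡a′
unhide (inj₂ (a≤d , a′≤d)) eq rewrite hide-≤ a≤d | hide-≤ a′≤d = eq

-- 0 marks a blank position.
PartialCode : ℕ → Code → Set
PartialCode d (a , b) = a ≤ d × b ≤ d × (a ≡ b → a ≡ 0)

Distinguishes : ℕ → List Code → Code → Code → Set
Distinguishes d P (a , b) (a′ , b′) =
  PartialCode d (a , b) → PartialCode d (a′ , b′) → (a ≡ᵇ 0) ≡ (a′ ≡ᵇ 0) → (b ≡ᵇ 0) ≡ (b′ ≡ᵇ 0) →
  answers P (a , b) ≡ answers P (a′ , b′) → (a , b) ≡ (a′ , b′)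

Separates : ℕ → List Code → Set
Separates d P = ∀ S S′ → Distinguishes d P S S′

hide-partialCode : ∀ {d a b} → (a ≡ b → a ≡ 0) → PartialCode d (hide d a , hide d b)
hide-partialCode {d} {a} {b} a≡b⇒blank with a ≤? d | b ≤? d
... | yes a≤d | yes b≤d = a≤d , b≤d , a≡b⇒blank
... | yes a≤d | no _ = a≤d , z≤n , λ a≡0 → a≡0
... | no _ | yes b≤d = z≤n , b≤d , λ _ → refl
... | no _ | no _ = z≤n , z≤n , λ _ → refl

hide-blank : ∀ {d a a′} → AgreeAbove d a a′ → (a ≡ᵇ 0) ≡ (a′ ≡ᵇ 0) → (hide d a ≡ᵇ 0) ≡ (hide d a′ ≡ᵇ 0)
hide-blank (inj₁ refl) _ = refl
hide-blank (inj₂ (a≤d , a′≤d)) eq rewrite hide-≤ a≤d | hide-≤ a′≤d = eq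

separates-++-block : ∀ {d P} → All (ValidCode d) P → Separates d P → Separates (3 + d) (P ++ block d)
separates-++-block {d} {P} valid separates (a , b) (a′ , b′)
  (a≤ , b≤ , a≡b⇒blank) (a′≤ , b′≤ , a′≡b′⇒blank) blank-a blank-b eq
  with answers-++⁻ P (block d) eq
... | eqP , eqB with block-reveals d a≤ b≤ a′≤ b′≤ eqB
... | agree-a , agree-b = cong₂ _,_ (unhide agree-a (,-injectiveˡ hidden)) (unhide agree-b (,-injectiveʳ hidden))
  where
  hidden : (hide d a , hide d b) ≡ (hide d a′ , hide d b′)
  hidden = separates _ _ (hide-partialCode a≡b⇒blank) (hide-partialCode a′≡b′⇒blank)
             (hide-blank agree-a blank-a) (hide-blank agree-b blank-b)
             (trans (sym (answers-hide valid)) (trans eqP (answers-hide valid)))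

separates⇒feasible : ∀ {c P} → Separates c P → Feasible c P
separates⇒feasible separates (suc a , suc b) (suc a′ , suc b′)
  ((_ , a≤) , (_ , b≤) , a≢b) ((_ , a′≤) , (_ , b′≤) , a′≢b′) =
  separates _ _ (a≤ , b≤ , ⊥-elim ∘ a≢b) (a′≤ , b′≤ , ⊥-elim ∘ a′≢b′) refl refl

block-valid : ∀ d → All (ValidCode (3 + d)) (block d)
block-valid d = (color₁ , color₃ , λ ()) ∷ (color₃ , color₁ , λ ())
              ∷ (color₂ , color₃ , λ ()) ∷ (color₃ , color₂ , λ ()) ∷ []
  where
  color₁ : Color (3 + d) (1 + d)
  color₁ = s≤s z≤n , m≤n+m (1 + d) 2
  color₂ : Color (3 + d) (2 + d)
  color₂ = s≤s z≤n , m≤n+m (2 + d) 1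
  color₃ : Color (3 + d) (3 + d)
  color₃ = s≤s z≤n , ≤-refl

block-unique : ∀ d → Unique (block d)
block-unique d = ((λ ()) ∷ (λ ()) ∷ (λ ()) ∷ []) ∷ ((λ ()) ∷ (λ ()) ∷ []) ∷ ((λ ()) ∷ []) ∷ [] ∷ []

block-fresh : ∀ {d q} → q ∈ block d → d < proj₁ q
block-fresh {d} (here refl) = m≤n+m (1 + d) 0
block-fresh {d} (there (here refl)) = m≤n+m (1 + d) 2
block-fresh {d} (there (there (here refl))) = m≤n+m (1 + d) 1
block-fresh {d} (there (there (there (here refl)))) = m≤n+m (1 + d) 2

record Separating (d : ℕ) (P : List Code) : Set where
  field
    valid : All (ValidCode d) P
    unique : Unique P
    separates : Separates d P

separating-++-block : ∀ {d P} → Separating d P → Separating (3 + d) (P ++ block d)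
separating-++-block {d} {P} record { valid = valid ; unique = unique ; separates = separates } = record
  { valid = All.++⁺ (All.map weaken valid) (block-valid d)
  ; unique = Unique.++⁺ unique (block-unique d) disjoint
  ; separates = separates-++-block valid separates
  }
  where
  weaken : ∀ {q} → ValidCode d q → ValidCode (3 + d) q
  weaken ((1≤x , x≤d) , (1≤y , y≤d) , x≢y) = (1≤x , m≤n⇒m≤o+n 3 x≤d) , (1≤y , m≤n⇒m≤o+n 3 y≤d) , x≢y
  disjoint : Disjoint P (block d)
  disjoint (q∈P , q∈block) = <⇒≱ (block-fresh q∈block) (proj₂ (proj₁ (All.lookup valid q∈P)))

validCode? : ∀ c S → Dec (ValidCode c S)
validCode? c (a , b) = ((1 ≤? a) ×-dec (a ≤? c)) ×-dec ((1 ≤? b) ×-dec (b ≤? c)) ×-dec ¬? (a ≟ b)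

partialCode? : ∀ d S → Dec (PartialCode d S)
partialCode? d (a , b) = (a ≤? d) ×-dec (b ≤? d) ×-dec ((a ≟ b) →-dec (a ≟ 0))

distinguishes? : ∀ d P S S′ → Dec (Distinguishes d P S S′)
distinguishes? d P S@(a , b) S′@(a′ , b′) =
  partialCode? d S →-dec partialCode? d S′ →-dec (a ≡ᵇ 0) Bool.≟ (a′ ≡ᵇ 0) →-dec (b ≡ᵇ 0) Bool.≟ (b′ ≡ᵇ 0) →-dec
  List.≡-dec _≟_ (answers P S) (answers P S′) →-dec S ≟ᶜ S′

separatingBySearch? : ∀ d P → Dec (All (ValidCode d) P × Unique P × AllCodePairs d (Distinguishes d P))
separatingBySearch? d P =
  All.all? (validCode? d) P ×-dec allPairs? (λ q q′ → ¬? (q ≟ᶜ q′)) P ×-dec allCodePairs? d (distinguishes? d P)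

separating-by-search : ∀ d P → True (separatingBySearch? d P) → Separating d P
separating-by-search d P found with toWitness found
... | valid , unique , checked = record
  { valid = valid
  ; unique = unique
  ; separates = λ { (a , b) (a′ , b′) S@(a≤ , b≤ , _) S′@(a′≤ , b′≤ , _) → lookupCodePair checked a≤ b≤ a′≤ b′≤ S S′ }
  }

base-separating : ∀ t → 2 ≤ t → t ≤ 4 → Separating t (base t)
base-separating 2 _ _ = separating-by-search 2 (base 2) tt
base-separating 3 _ _ = separating-by-search 3 (base 3) tt
base-separating 4 _ _ = separating-by-search 4 (base 4) tt
base-separating (suc (suc (suc (suc (suc _))))) _ (s≤s (s≤s (s≤s (s≤s ()))))
base-separating 0 () _
base-separating 1 (s≤s ()) _

strategy-separating : ∀ s t → 2 ≤ t → t ≤ 4 → Separating (t + 3 * s) (strategy s t)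
strategy-separating zero t 2≤t t≤4 =
  subst₂ Separating (sym (+-identityʳ t)) (sym (++-identityʳ (base t))) (base-separating t 2≤t t≤4)
strategy-separating (suc s) t 2≤t t≤4 =
  subst₂ Separating (shift t s) (++-assoc (base t) (blocks t s) _)
    (separating-++-block (strategy-separating s t 2≤t t≤4))
  where
  shift : ∀ t s → 3 + (t + 3 * s) ≡ t + 3 * suc s
  shift = solve-∀

-- Lower bound on the number of questions

𝟙[n≟1]-absorbs : ∀ n → n * 𝟙 (n ≟ 1) ≡ 𝟙 (n ≟ 1)
𝟙[n≟1]-absorbs 0 = refl
𝟙[n≟1]-absorbs 1 = refl
𝟙[n≟1]-absorbs (suc (suc n)) = *-zeroʳ (suc (suc n))

two-≤-deficit : ∀ n → 2 ≤ n + 𝟙 (n ≟ 1) + 2 * 𝟙 (n ≟ 0)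
two-≤-deficit 0 = ≤-refl
two-≤-deficit 1 = ≤-refl
two-≤-deficit (suc (suc n)) = m≤m+n 2 _

counting-bound : ∀ {A : Set} {c} (qs : List A) (key : A → ℕ) → All (λ q → key q ∈ colors c) qs →
  2 * c ≤ length qs + ∑[ q ∈ qs ] 𝟙 (degree key qs (key q) ≟ 1) + 2 * length (filter (λ v → degree key qs v ≟ 0) (colors c))
counting-bound {c = c} qs key keys∈ = begin
  2 * c                                        ≡⟨ *-comm 2 c ⟩
  c * 2                                        ≡⟨ cong (_* 2) (sym (length-applyUpTo suc c)) ⟩
  length (colors c) * 2                        ≡⟨ sym (∑-const (colors c) 2) ⟩
  ∑[ _ ∈ colors c ] 2                          ≤⟨ ∑-mono-≤ (colors c) (λ v → two-≤-deficit (d v)) ⟩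
  ∑[ v ∈ colors c ] (d v + 𝟙 (d v ≟ 1) + 2 * 𝟙 (d v ≟ 0))
    ≡⟨ trans (∑-+ (colors c) _ _) (cong₂ _+_ (∑-+ (colors c) _ _) (∑-*ˡ (colors c) 2 _)) ⟩
  ∑[ v ∈ colors c ] d v + ∑[ v ∈ colors c ] 𝟙 (d v ≟ 1) + 2 * ∑[ v ∈ colors c ] 𝟙 (d v ≟ 0)
    ≡⟨ cong₂ _+_ (cong₂ _+_ (handshake key qs (colors-unique c) keys∈) singles) (cong (2 *_) (∑-filter _ (colors c))) ⟩
  length qs + ∑[ q ∈ qs ] 𝟙 (d (key q) ≟ 1) + 2 * length (filter (λ v → d v ≟ 0) (colors c)) ∎
  where
  open ≤-Reasoning
  d : ℕ → ℕ
  d = degree key qs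
  singles : ∑[ v ∈ colors c ] 𝟙 (d v ≟ 1) ≡ ∑[ q ∈ qs ] 𝟙 (d (key q) ≟ 1)
  singles = trans (∑-cong (colors c) (λ v → sym (𝟙[n≟1]-absorbs (d v))))
                  (sym (∑-degree key qs (λ v → 𝟙 (d v ≟ 1)) (colors-unique c) keys∈))

all-equal⇒length≤1 : ∀ {A : Set} {xs : List A} → Unique xs → (∀ {x y} → x ∈ xs → y ∈ xs → x ≡ y) → length xs ≤ 1
all-equal⇒length≤1 {xs = []} _ _ = z≤n
all-equal⇒length≤1 {xs = _ ∷ []} _ _ = ≤-refl
all-equal⇒length≤1 {xs = _ ∷ _ ∷ _} ((x≢y ∷ _) ∷ _) all-equal = ⊥-elim (x≢y (all-equal (here refl) (there (here refl))))

allPairs-of-distinct : ∀ {A : Set} {P : A → Set} {R : A → A → Set} {xs} →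
  (∀ {x y} → P x → P y → x ≢ y → R x y) → All P xs → Unique xs → AllPairs R xs
allPairs-of-distinct r [] [] = []
allPairs-of-distinct r (px ∷ pxs) (x≢xs ∷ unique) =
  All.zipWith (λ (py , x≢y) → r px py x≢y) (pxs , x≢xs) ∷ allPairs-of-distinct r pxs unique

∃-∈ : ∀ {A : Set} {xs : List A} → 1 ≤ length xs → ∃[ x ] x ∈ xs
∃-∈ {xs = x ∷ _} _ = x , here refl

Apart : Code → Code → Set
Apart (a , b) (a′ , b′) = a ≢ a′ × b ≢ b′

Linked : Code → Code → Set
Linked (a , b) (a′ , b′) = a ≡ b′ ⊎ a′ ≡ b

linked-star : ∀ {e₁ e₂ e₃ e₄} → Linked e₁ e₂ → Linked e₁ e₃ → Linked e₁ e₄ →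
              Apart e₂ e₃ → Apart e₂ e₄ → Apart e₃ e₄ → ⊥
linked-star (inj₁ p) (inj₁ q) _        (_ , b₂≢b₃) _ _ = b₂≢b₃ (trans (sym p) q)
linked-star (inj₂ p) (inj₂ q) _        (a₂≢a₃ , _) _ _ = a₂≢a₃ (trans p (sym q))
linked-star (inj₁ p) (inj₂ q) (inj₁ r) _ (_ , b₂≢b₄) _ = b₂≢b₄ (trans (sym p) r)
linked-star (inj₁ p) (inj₂ q) (inj₂ r) _ _ (a₃≢a₄ , _) = a₃≢a₄ (trans q (sym r))
linked-star (inj₂ p) (inj₁ q) (inj₁ r) _ _ (_ , b₃≢b₄) = b₃≢b₄ (trans (sym q) r)
linked-star (inj₂ p) (inj₁ q) (inj₂ r) _ (a₂≢a₄ , _) _ = a₂≢a₄ (trans p (sym r))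

linked⇒length≤3 : ∀ {F} → AllPairs (λ e f → Apart e f × Linked e f) F → length F ≤ 3
linked⇒length≤3 [] = z≤n
linked⇒length≤3 (_ ∷ []) = s≤s z≤n
linked⇒length≤3 (_ ∷ _ ∷ []) = s≤s (s≤s z≤n)
linked⇒length≤3 (_ ∷ _ ∷ _ ∷ []) = ≤-refl
linked⇒length≤3 (((_ , l₁₂) ∷ (_ , l₁₃) ∷ (_ , l₁₄) ∷ _) ∷ ((a₂₃ , _) ∷ (a₂₄ , _) ∷ _) ∷ ((a₃₄ , _) ∷ _) ∷ _) =
  ⊥-elim (linked-star l₁₂ l₁₃ l₁₄ a₂₃ a₂₄ a₃₄)

Through : ℕ → ℕ → Code → Set
Through z w (a , b) = b ≡ z ⊎ a ≡ w

through-pigeonhole : ∀ {z w e₁ e₂ e₃} → Through z w e₁ → Through z w e₂ → Through z w e₃ →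
                     Apart e₁ e₂ → Apart e₁ e₃ → Apart e₂ e₃ → ⊥
through-pigeonhole (inj₁ p) (inj₁ q) _        (_ , b₁≢b₂) _ _ = b₁≢b₂ (trans p (sym q))
through-pigeonhole (inj₂ p) (inj₂ q) _        (a₁≢a₂ , _) _ _ = a₁≢a₂ (trans p (sym q))
through-pigeonhole (inj₁ p) (inj₂ q) (inj₁ r) _ (_ , b₁≢b₃) _ = b₁≢b₃ (trans p (sym r))
through-pigeonhole (inj₁ p) (inj₂ q) (inj₂ r) _ _ (a₂≢a₃ , _) = a₂≢a₃ (trans q (sym r))
through-pigeonhole (inj₂ p) (inj₁ q) (inj₁ r) _ _ (_ , b₂≢b₃) = b₂≢b₃ (trans q (sym r))
through-pigeonhole (inj₂ p) (inj₁ q) (inj₂ r) _ (a₁≢a₃ , _) _ = a₁≢a₃ (trans p (sym r))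

through⇒length≤2 : ∀ {z w F} → All (Through z w) F → AllPairs Apart F → length F ≤ 2
through⇒length≤2 [] _ = z≤n
through⇒length≤2 (_ ∷ []) _ = s≤s z≤n
through⇒length≤2 (_ ∷ _ ∷ []) _ = ≤-refl
through⇒length≤2 (t₁ ∷ t₂ ∷ t₃ ∷ _) ((a₁₂ ∷ a₁₃ ∷ _) ∷ (a₂₃ ∷ _) ∷ _) =
  ⊥-elim (through-pigeonhole t₁ t₂ t₃ a₁₂ a₁₃ a₂₃)

avoiding : ∀ z z′ → ∃[ b ] (Color 3 b × z ≢ b × z′ ≢ b)
avoiding z z′ with z ≟ 1 | z′ ≟ 1 | z ≟ 2 | z′ ≟ 2
... | no z≢1 | no z′≢1 | _ | _ = 1 , (s≤s z≤n , s≤s z≤n) , z≢1 , z′≢1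
... | _ | _ | no z≢2 | no z′≢2 = 2 , (s≤s z≤n , s≤s (s≤s z≤n)) , z≢2 , z′≢2
... | yes refl | _ | yes () | _
... | _ | yes refl | _ | yes ()
... | yes refl | _ | no _ | yes refl = 3 , (s≤s z≤n , ≤-refl) , (λ ()) , (λ ())
... | _ | yes refl | yes refl | no _ = 3 , (s≤s z≤n , ≤-refl) , (λ ()) , (λ ())

unasked-isolated-bound : ∀ {i u w} → u ≤ 1 → w ≤ 1 → i ≤ 3 → (1 ≤ u → 1 ≤ w → i ≤ 2) → i + 2 * (u + w) ≤ 6
unasked-isolated-bound {i} z≤n z≤n i≤3 _ = ≤-trans (+-monoˡ-≤ 0 i≤3) (m≤m+n 3 3)
unasked-isolated-bound {i} z≤n (s≤s z≤n) i≤3 _ = +-monoˡ-≤ 2 (≤-trans i≤3 (n≤1+n 3))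
unasked-isolated-bound {i} (s≤s z≤n) z≤n i≤3 _ = +-monoˡ-≤ 2 (≤-trans i≤3 (n≤1+n 3))
unasked-isolated-bound {i} (s≤s z≤n) (s≤s z≤n) _ i≤2 = +-monoˡ-≤ 4 (i≤2 ≤-refl ≤-refl)

combine-bounds : ∀ c K {N₁ N₂ Z₁ Z₂ I} → 2 * c ≤ K + N₁ + 2 * Z₁ → 2 * c ≤ K + N₂ + 2 * Z₂ →
                 N₁ + N₂ ≤ K + I → I + 2 * (Z₁ + Z₂) ≤ 6 → 4 * c ≤ 3 * K + 6
combine-bounds c K {N₁} {N₂} {Z₁} {Z₂} {I} out-bound in-bound singles rest = begin
  4 * c                                       ≡⟨ double c ⟩
  2 * c + 2 * c                               ≤⟨ +-mono-≤ out-bound in-bound ⟩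
  K + N₁ + 2 * Z₁ + (K + N₂ + 2 * Z₂)          ≡⟨ regroup K N₁ N₂ Z₁ Z₂ ⟩
  2 * K + (N₁ + N₂) + 2 * (Z₁ + Z₂)           ≤⟨ +-monoˡ-≤ (2 * (Z₁ + Z₂)) (+-monoʳ-≤ (2 * K) singles) ⟩
  2 * K + (K + I) + 2 * (Z₁ + Z₂)             ≡⟨ regroup′ K I (Z₁ + Z₂) ⟩
  3 * K + (I + 2 * (Z₁ + Z₂))                 ≤⟨ +-monoʳ-≤ (3 * K) rest ⟩
  3 * K + 6                                   ∎
  where
  open ≤-Reasoning
  double : ∀ c → 4 * c ≡ 2 * c + 2 * c
  double = solve-∀
  regroup : ∀ K N₁ N₂ Z₁ Z₂ → K + N₁ + 2 * Z₁ + (K + N₂ + 2 * Z₂) ≡ 2 * K + (N₁ + N₂) + 2 * (Z₁ + Z₂)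
  regroup = solve-∀
  regroup′ : ∀ K I Z → 2 * K + (K + I) + 2 * Z ≡ 3 * K + (I + 2 * Z)
  regroup′ = solve-∀

module LowerBound {c : ℕ} {qs : List Code}
  (valid : All (ValidCode c) qs) (unique : Unique qs) (feasible : Feasible c qs) where

  outdeg indeg : ℕ → ℕ
  outdeg = degree proj₁ qs
  indeg = degree proj₂ qs

  same-answers⇒≡ : ∀ {S S′} → ValidCode c S → ValidCode c S′ →
                   (∀ {q} → q ∈ qs → answer q S ≡ answer q S′) → S ≡ S′
  same-answers⇒≡ valid-S valid-S′ same = feasible _ _ valid-S valid-S′ (map-cong-local (All.tabulate same))

  first-color : ∀ {q} → q ∈ qs → Color c (proj₁ q)
  first-color q∈ = proj₁ (All.lookup valid q∈)

  second-color : ∀ {q} → q ∈ qs → Color c (proj₂ q)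
  second-color q∈ = proj₁ (proj₂ (All.lookup valid q∈))

  widen : ∀ {v} → 3 ≤ c → Color 3 v → Color c v
  widen 3≤c (1≤v , v≤3) = 1≤v , ≤-trans v≤3 3≤c

  unasked-first : 3 ≤ c → ∀ {z z′} → Color c z → Color c z′ → outdeg z ≡ 0 → outdeg z′ ≡ 0 → z ≡ z′
  unasked-first 3≤c {z} {z′} z-color z′-color out-z out-z′ with avoiding z z′
  ... | b , b-color , z≢b , z′≢b =
    ,-injectiveˡ (same-answers⇒≡ (z-color , widen 3≤c b-color , z≢b) (z′-color , widen 3≤c b-color , z′≢b) same)
    where
    same : ∀ {q} → q ∈ qs → answer q (z , b) ≡ answer q (z′ , b)
    same {x , y} q∈ = cong (_+ δ y b) (trans (δ-≢ (degree-zero proj₁ out-z q∈)) (sym (δ-≢ (degree-zero proj₁ out-z′ q∈))))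

  unasked-second : 3 ≤ c → ∀ {w w′} → Color c w → Color c w′ → indeg w ≡ 0 → indeg w′ ≡ 0 → w ≡ w′
  unasked-second 3≤c {w} {w′} w-color w′-color in-w in-w′ with avoiding w w′
  ... | a , a-color , w≢a , w′≢a =
    ,-injectiveʳ (same-answers⇒≡ (widen 3≤c a-color , w-color , w≢a ∘ sym) (widen 3≤c a-color , w′-color , w′≢a ∘ sym) same)
    where
    same : ∀ {q} → q ∈ qs → answer q (a , w) ≡ answer q (a , w′)
    same {x , y} q∈ = cong (δ x a +_) (trans (δ-≢ (degree-zero proj₂ in-w q∈)) (sym (δ-≢ (degree-zero proj₂ in-w′ q∈))))

  Isolated : Code → Set
  Isolated (a , b) = outdeg a ≡ 1 × indeg b ≡ 1

  isolated? : ∀ q → Dec (Isolated q)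
  isolated? (a , b) = (outdeg a ≟ 1) ×-dec (indeg b ≟ 1)

  -- Both sides are the indicator of q ≡ e.
  isolated-δ : ∀ {e q} → e ∈ qs → Isolated e → q ∈ qs → δ (proj₁ q) (proj₁ e) ≡ δ (proj₂ q) (proj₂ e)
  isolated-δ {a , b} {x , y} e∈ (out-a , in-b) q∈ with x ≟ a | y ≟ b
  ... | yes _ | yes _ = refl
  ... | no _ | no _ = refl
  ... | yes x≡a | no y≢b = ⊥-elim (y≢b (,-injectiveʳ (degree-one proj₁ out-a q∈ e∈ x≡a refl)))
  ... | no x≢a | yes y≡b = ⊥-elim (x≢a (,-injectiveˡ (degree-one proj₂ in-b q∈ e∈ y≡b refl)))

  isolated-apart : ∀ {e f} → e ∈ qs → f ∈ qs → Isolated e → e ≢ f → Apart e f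
  isolated-apart e∈ f∈ (out-a , in-b) e≢f =
    (λ a≡a′ → e≢f (degree-one proj₁ out-a e∈ f∈ refl (sym a≡a′))) ,
    (λ b≡b′ → e≢f (degree-one proj₂ in-b e∈ f∈ refl (sym b≡b′)))

  isolated-linked : ∀ {e f} → e ∈ qs → f ∈ qs → Isolated e → Isolated f → e ≢ f → Linked e f
  isolated-linked {a , b′} {a′ , b} e∈ f∈ iso-e iso-f e≢f with a ≟ b | a′ ≟ b′
  ... | yes a≡b | _ = inj₁ a≡b
  ... | no _ | yes a′≡b′ = inj₂ a′≡b′
  ... | no a≢b | no a′≢b′ = ⊥-elim (proj₁ (isolated-apart e∈ f∈ iso-e e≢f) (,-injectiveˡ crossed))
    where
    crossed : (a , b) ≡ (a′ , b′)
    crossed = same-answers⇒≡ (first-color e∈ , second-color f∈ , a≢b) (first-color f∈ , second-color e∈ , a′≢b′) λ {(x , y)} q∈ → begin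
      δ x a + δ y b   ≡⟨ cong₂ _+_ (isolated-δ e∈ iso-e q∈) (sym (isolated-δ f∈ iso-f q∈)) ⟩
      δ y b′ + δ x a′ ≡⟨ +-comm (δ y b′) (δ x a′) ⟩
      δ x a′ + δ y b′ ∎
      where open ≡-Reasoning

  isolated-through : ∀ {z w f} → Color c z → Color c w → outdeg z ≡ 0 → indeg w ≡ 0 →
                     f ∈ qs → Isolated f → Through z w f
  isolated-through {z} {w} {a′ , b} z-color w-color out-z in-w f∈ iso-f with b ≟ z | a′ ≟ w
  ... | yes b≡z | _ = inj₁ b≡z
  ... | no _ | yes a′≡w = inj₂ a′≡w
  ... | no b≢z | no a′≢w = ⊥-elim (degree-zero proj₁ out-z f∈ (sym (,-injectiveˡ crossed)))
    where
    crossed : (z , b) ≡ (a′ , w)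
    crossed = same-answers⇒≡ (z-color , second-color f∈ , b≢z ∘ sym) (first-color f∈ , w-color , a′≢w) λ {(x , y)} q∈ → begin
      δ x z + δ y b   ≡⟨ cong₂ _+_ (δ-≢ (degree-zero proj₁ out-z q∈)) (sym (isolated-δ f∈ iso-f q∈)) ⟩
      0 + δ x a′      ≡⟨ +-comm 0 (δ x a′) ⟩
      δ x a′ + 0      ≡⟨ cong (δ x a′ +_) (sym (δ-≢ (degree-zero proj₂ in-w q∈))) ⟩
      δ x a′ + δ y w  ∎
      where open ≡-Reasoning

  ∈-unasked : ∀ {deg : ℕ → ℕ} {v} → v ∈ filter (λ u → deg u ≟ 0) (colors c) → Color c v × deg v ≡ 0
  ∈-unasked {deg} v∈ with ∈-filter⁻ (λ u → deg u ≟ 0) {xs = colors c} v∈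
  ... | v∈colors , deg≡0 = ∈-colors⁻ v∈colors , deg≡0

  unasked-out unasked-in : List ℕ
  unasked-out = filter (λ v → outdeg v ≟ 0) (colors c)
  unasked-in = filter (λ v → indeg v ≟ 0) (colors c)

  isolated : List Code
  isolated = filter isolated? qs

  unasked-out-≤1 : 3 ≤ c → length unasked-out ≤ 1
  unasked-out-≤1 3≤c = all-equal⇒length≤1 (Unique.filter⁺ _ (colors-unique c)) λ z∈ z′∈ →
    unasked-first 3≤c (proj₁ (∈-unasked z∈)) (proj₁ (∈-unasked z′∈)) (proj₂ (∈-unasked z∈)) (proj₂ (∈-unasked z′∈))

  unasked-in-≤1 : 3 ≤ c → length unasked-in ≤ 1
  unasked-in-≤1 3≤c = all-equal⇒length≤1 (Unique.filter⁺ _ (colors-unique c)) λ w∈ w′∈ →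
    unasked-second 3≤c (proj₁ (∈-unasked w∈)) (proj₁ (∈-unasked w′∈)) (proj₂ (∈-unasked w∈)) (proj₂ (∈-unasked w′∈))

  isolated-pairs : AllPairs (λ e f → Apart e f × Linked e f) isolated
  isolated-pairs = allPairs-of-distinct
    (λ (e∈ , iso-e) (f∈ , iso-f) e≢f → isolated-apart e∈ f∈ iso-e e≢f , isolated-linked e∈ f∈ iso-e iso-f e≢f)
    (All.tabulate (∈-filter⁻ isolated?)) (Unique.filter⁺ isolated? unique)

  isolated-≤2 : ∀ {z w} → z ∈ unasked-out → w ∈ unasked-in → length isolated ≤ 2
  isolated-≤2 z∈ w∈ = through⇒length≤2 (All.tabulate through) (AllPairs.map proj₁ isolated-pairs)
    where
    through : ∀ {f} → f ∈ isolated → Through _ _ f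
    through f∈ with ∈-filter⁻ isolated? f∈
    ... | f∈qs , iso-f = isolated-through (proj₁ (∈-unasked z∈)) (proj₁ (∈-unasked w∈))
                           (proj₂ (∈-unasked z∈)) (proj₂ (∈-unasked w∈)) f∈qs iso-f

  singles-bound : ∑[ q ∈ qs ] 𝟙 (outdeg (proj₁ q) ≟ 1) + ∑[ q ∈ qs ] 𝟙 (indeg (proj₂ q) ≟ 1) ≤ length qs + length isolated
  singles-bound = begin
    ∑[ q ∈ qs ] 𝟙 (outdeg (proj₁ q) ≟ 1) + ∑[ q ∈ qs ] 𝟙 (indeg (proj₂ q) ≟ 1)
      ≡⟨ sym (∑-+ qs _ _) ⟩
    ∑[ q ∈ qs ] (𝟙 (outdeg (proj₁ q) ≟ 1) + 𝟙 (indeg (proj₂ q) ≟ 1))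
      ≤⟨ ∑-mono-≤ qs (λ q → 𝟙-pair (outdeg (proj₁ q) ≟ 1) (indeg (proj₂ q) ≟ 1)) ⟩
    ∑[ q ∈ qs ] (1 + 𝟙 (isolated? q))
      ≡⟨ ∑-+ qs _ _ ⟩
    ∑[ _ ∈ qs ] 1 + ∑[ q ∈ qs ] 𝟙 (isolated? q)
      ≡⟨ cong₂ _+_ (trans (∑-const qs 1) (*-identityʳ (length qs))) (∑-filter isolated? qs) ⟩
    length qs + length isolated ∎
    where open ≤-Reasoning

  bound : 3 ≤ c → 4 * c ≤ 3 * length qs + 6
  bound 3≤c = combine-bounds c (length qs) {Z₁ = length unasked-out} {length unasked-in} {length isolated}
    (counting-bound qs proj₁ (All.map (λ v → ∈-colors⁺ (proj₁ v)) valid))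
    (counting-bound qs proj₂ (All.map (λ v → ∈-colors⁺ (proj₁ (proj₂ v))) valid))
    singles-bound
    (unasked-isolated-bound (unasked-out-≤1 3≤c) (unasked-in-≤1 3≤c) (linked⇒length≤3 isolated-pairs)
      λ 1≤u 1≤w → isolated-≤2 (proj₂ (∃-∈ 1≤u)) (proj₂ (∃-∈ 1≤w)))

-- Number of questions

⌈/3⌉∸2-≤ : ∀ n K → n ≤ 3 * K + 6 → ⌈ n /3⌉ ∸ 2 ≤ K
⌈/3⌉∸2-≤ n K n≤ = m≤n+o⇒m∸n≤o ((n + 2) / 3) 2 (s≤s⁻¹ (m<n*o⇒m/o<n n+2<))
  where
  n+2< : n + 2 < (3 + K) * 3
  n+2< = begin
    suc (n + 2)    ≡⟨ sym (+-suc n 2) ⟩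
    n + 3          ≤⟨ +-monoˡ-≤ 3 n≤ ⟩
    3 * K + 6 + 3  ≡⟨ regroup K ⟩
    (3 + K) * 3    ∎
    where
    open ≤-Reasoning
    regroup : ∀ K → 3 * K + 6 + 3 ≡ (3 + K) * 3
    regroup = solve-∀

⌈/3⌉∸2-exact : ∀ n k r → r < 3 → n + 2 ≡ (2 + k) * 3 + r → ⌈ n /3⌉ ∸ 2 ≡ k
⌈/3⌉∸2-exact n k r r<3 eq = cong (_∸ 2) (begin
  (n + 2) / 3                   ≡⟨ /-congˡ eq ⟩
  ((2 + k) * 3 + r) / 3         ≡⟨ +-distrib-/-∣ˡ r (n∣m*n (2 + k)) ⟩
  (2 + k) * 3 / 3 + r / 3       ≡⟨ cong₂ _+_ (m*n/n≡m (2 + k) 3) (m<n⇒m/n≡0 r<3) ⟩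
  2 + k + 0                     ≡⟨ +-identityʳ (2 + k) ⟩
  2 + k                         ∎)
  where open ≡-Reasoning

lower-bound : ∀ c → 2 ≤ c → (qs : List Code) → All (ValidCode c) qs → Unique qs → Feasible c qs →
              ⌈ 4 * c /3⌉ ∸ 2 ≤ length qs
lower-bound 2 _ [] _ _ feasible with feasible (1 , 2) (2 , 1) ((≤-refl , s≤s z≤n) , (s≤s z≤n , ≤-refl) , λ ())
                                      ((s≤s z≤n , ≤-refl) , (≤-refl , s≤s z≤n) , λ ()) refl
... | ()
lower-bound 2 _ (_ ∷ _) _ _ _ = s≤s z≤n
lower-bound 1 (s≤s ()) _ _ _ _
lower-bound c@(suc (suc (suc _))) _ qs valid unique feasible =
  ⌈/3⌉∸2-≤ (4 * c) (length qs) (LowerBound.bound valid unique feasible (s≤s (s≤s (s≤s z≤n))))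

blocks-length : ∀ t s → length (blocks t s) ≡ 4 * s
blocks-length t zero = refl
blocks-length t (suc s) = begin
  length (blocks t s ++ block (t + 3 * s)) ≡⟨ length-++ (blocks t s) ⟩
  length (blocks t s) + 4                 ≡⟨ cong (_+ 4) (blocks-length t s) ⟩
  4 * s + 4                               ≡⟨ four-more s ⟩
  4 * suc s                               ∎
  where
  open ≡-Reasoning
  four-more : ∀ s → 4 * s + 4 ≡ 4 * suc s
  four-more = solve-∀

strategy-length : ∀ s t → 2 ≤ t → t ≤ 4 → length (strategy s t) ≡ ⌈ 4 * (3 * s + t) /3⌉ ∸ 2
strategy-length s t 2≤t t≤4 rewrite length-++ (base t) {blocks t s} | blocks-length t s = sym (exact t 2≤t t≤4)
  where
  exact : ∀ t → 2 ≤ t → t ≤ 4 → ⌈ 4 * (3 * s + t) /3⌉ ∸ 2 ≡ length (base t) + 4 * s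
  exact 2 _ _ = ⌈/3⌉∸2-exact _ _ 1 (s≤s (s≤s z≤n)) (eq s)
    where eq : ∀ s → 4 * (3 * s + 2) + 2 ≡ (2 + (1 + 4 * s)) * 3 + 1
          eq = solve-∀
  exact 3 _ _ = ⌈/3⌉∸2-exact _ _ 2 ≤-refl (eq s)
    where eq : ∀ s → 4 * (3 * s + 3) + 2 ≡ (2 + (2 + 4 * s)) * 3 + 2
          eq = solve-∀
  exact 4 _ _ = ⌈/3⌉∸2-exact _ _ 0 (s≤s z≤n) (eq s)
    where eq : ∀ s → 4 * (3 * s + 4) + 2 ≡ (2 + (4 + 4 * s)) * 3 + 0
          eq = solve-∀
  exact 0 () _
  exact 1 (s≤s ()) _
  exact (suc (suc (suc (suc (suc _))))) _ (s≤s (s≤s (s≤s (s≤s ()))))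

theorem1 : (c s t : ℕ) → 2 ≤ c → 2 ≤ t → t ≤ 4 → c ≡ 3 * s + t →
    (length (strategy s t) ≡ ⌈ 4 * c /3⌉ ∸ 2)
    × All (ValidCode c) (strategy s t)
    × Unique (strategy s t)
    × Feasible c (strategy s t)
    × ((qs : List Code) → All (ValidCode c) qs → Unique qs → Feasible c qs →
        ⌈ 4 * c /3⌉ ∸ 2 ≤ length qs)
theorem1 c s t 2≤c 2≤t t≤4 refl =
  strategy-length s t 2≤t t≤4 , valid , unique , separates⇒feasible separates , lower-bound c 2≤c
  where
  open Separating (subst (λ d → Separating d (strategy s t)) (+-comm t (3 * s)) (strategy-separating s t 2≤t t≤4))
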